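{- For every positive integer $n$, there is exactly one ballot permutation of length $n$ avoiding both patterns $123$ and $132$, i.e. $|B_n(123,132)|=1$.
   Context: A permutation $\sigma\in S_n$ is written as $\sigma(1)\cdots\sigma(n)$. An index $i\in[n-1]$ is an ascent if $\sigma(i)<\sigma(i+1)$ and a descent if $\sigma(i)>\sigma(i+1)$. A ballot permutation is a permutation such that every prefix $\sigma(1)\cdots\sigma(p)$ has at least as many ascents as descents. $\sigma$ contains a pattern $\pi\in S_k$ if some subsequence $\sigma(c_1)\cdots\sigma(c_k)$ with $c_1<\dots<c_k$ is order-isomorphic to $\pi$, and avoids $\pi$ otherwise. $B_n(\pi_1,\dots,\pi_m)$ denotes the set of ballot permutations of length $n$ avoiding all of $\pi_1,\dots,\pi_m$. -}

module Defs where

open import Data.Nat using (ℕ; zero; suc; _+_; _≤_; _<_)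
open import Data.Fin using (Fin; toℕ) renaming (_<_ to _<ᶠ_)
open import Data.Fin.Permutation using (Permutation′; _⟨$⟩ʳ_)
open import Data.Product using (Σ; _×_)
open import Relation.Nullary using (¬_)
open import Function.Bundles using (_⇔_)

-- A permutation of length n: a bijection of Fin n (positions and values 0-based;
-- σ(i+1) in the paper corresponds to σ ⟨$⟩ʳ i here).
Perm : ℕ → Set
Perm n = Permutation′ n

-- Number of indices i < m (0-based, i.e. paper indices 1..m) with i+1 < n and
-- σ(i) < σ(i+1) (ascents), resp. σ(i) > σ(i+1) (descents).

module _ {n : ℕ} (σ : Perm n) where
  open import Data.Fin using (fromℕ<)
  open import Data.Nat using (_<?_)
  open import Relation.Nullary using (yes; no)
  open import Data.Maybe using (Maybe; just; nothing)

  val : ℕ → Maybe ℕ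
  val i with i <? n
  ... | yes p = just (toℕ (σ ⟨$⟩ʳ fromℕ< p))
  ... | no _  = nothing

  isAsc : ℕ → ℕ
  isAsc i with val i | val (suc i)
  ... | just a | just b with suc a Data.Nat.≤? b
  ...   | yes _ = 1
  ...   | no  _ = 0
  isAsc i | _ | _ = 0

  isDes : ℕ → ℕ
  isDes i with val i | val (suc i)
  ... | just a | just b with suc b Data.Nat.≤? a
  ...   | yes _ = 1
  ...   | no  _ = 0
  isDes i | _ | _ = 0

  ascBelow : ℕ → ℕ
  ascBelow zero = 0
  ascBelow (suc m) = ascBelow m + isAsc m

  desBelow : ℕ → ℕ
  desBelow zero = 0
  desBelow (suc m) = desBelow m + isDes m

-- Ballot: every prefix σ(1)⋯σ(p), 1 ≤ p ≤ n, has at least as many ascents as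
-- descents. The ascents/descents of that prefix are the indices i ∈ [p-1],
-- i.e. 0-based indices i < p - 1; we quantify over m = p - 1 < n.
IsBallot : {n : ℕ} → Perm n → Set
IsBallot {n} σ = (m : ℕ) → m < n → desBelow σ m ≤ ascBelow σ m

Contains : {n k : ℕ} → Perm n → Perm k → Set
Contains {n} {k} σ π =
  Σ (Fin k → Fin n) λ c →
    ((i j : Fin k) → i <ᶠ j → c i <ᶠ c j) ×
    ((i j : Fin k) → ((σ ⟨$⟩ʳ c i) <ᶠ (σ ⟨$⟩ʳ c j)) ⇔ ((π ⟨$⟩ʳ i) <ᶠ (π ⟨$⟩ʳ j)))

Avoids : {n k : ℕ} → Perm n → Perm k → Set
Avoids σ π = ¬ Contains σ π

open import Data.Fin using (zero; suc)
open import Data.Fin.Permutation using (id; transpose)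

p123 : Perm 3
p123 = id

p132 : Perm 3
p132 = transpose (suc zero) (suc (suc zero))

InB : {n : ℕ} → Perm n → Set
InB σ = IsBallot σ × Avoids σ p123 × Avoids σ p132

-- Avoiding both 123 and 132 means that every entry is exceeded by at most one later entry.
-- Then no two ascents are adjacent, so the ballot condition forces an ascent at every even
-- (0-based) position 2k, and σ(2k+1) is the only later entry exceeding σ(2k) while nothing
-- later exceeds σ(2k+1). Hence the members of B_n(123,132) are exactly the permutations whose
-- non-inversions are the pairs (2k, 2k+1); conversely such a permutation is a ballot
-- permutation avoiding both patterns. A permutation is determined by its inversion set, and
-- (n-1) n (n-3) (n-2) … has exactly these non-inversions.

module Submission where

open import Defs
open import Data.Nat using (ℕ; zero; suc; _+_; _≤_; _<_; z≤n; z<s; s<s; s<s⁻¹; _<?_; _≤?_)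
open import Data.Nat.Properties
open import Data.Fin using (Fin; toℕ; fromℕ<; opposite) renaming (suc to fsuc; _<_ to _<ᶠ_)
open import Data.Fin.Patterns using (0F; 1F; 2F)
open import Data.Fin.Properties using (toℕ-injective; toℕ-fromℕ<; fromℕ<-toℕ; toℕ<n; opposite-prop)
  renaming (<-cmp to <ᶠ-cmp)
open import Data.Fin.Permutation using (_⟨$⟩ʳ_; _⟨$⟩ˡ_; inverseˡ; inverseʳ; id; swap; reverse; _∘ₚ_)
open import Data.Maybe using (just; nothing)
open import Data.Product using (Σ; _×_; _,_; proj₁; proj₂)
open import Data.Sum using (_⊎_; inj₁; inj₂)
open import Data.Empty using (⊥; ⊥-elim)
open import Function using (_∘_)
open import Function.Bundles using (_⇔_; mk⇔; Equivalence)
open import Function.Construct.Composition using (_⇔-∘_)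
open import Function.Construct.Symmetry using (⇔-sym)
open import Relation.Binary.Definitions using (tri<; tri≈; tri>)
open import Relation.Nullary using (¬_; Dec; yes; no; contradiction)
open import Relation.Binary.PropositionalEquality

open Equivalence using (to; from)

⇔-both : {P Q : Set} → P → Q → P ⇔ Q
⇔-both p q = mk⇔ (λ _ → q) (λ _ → p)

⇔-neither : {P Q : Set} → ¬ P → ¬ Q → P ⇔ Q
⇔-neither ¬p ¬q = mk⇔ (⊥-elim ∘ ¬p) (⊥-elim ∘ ¬q)

data Even : ℕ → Set where
  even-zero : Even zero
  even-2+   : ∀ {n} → Even n → Even (suc (suc n))

even-or-odd : ∀ n → Even n ⊎ Even (suc n)
even-or-odd zero = inj₁ even-zero
even-or-odd (suc n) with even-or-odd n
... | inj₁ e = inj₂ (even-2+ e)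
... | inj₂ e = inj₁ e

BlockPair : ℕ → ℕ → Set
BlockPair i j = Even i × j ≡ suc i

blockPair-unique : ∀ {i j k} → BlockPair i j → BlockPair i k → j ≡ k
blockPair-unique (_ , refl) (_ , refl) = refl

blockPair-2+ : ∀ {i j} → BlockPair (suc (suc i)) (suc (suc j)) ⇔ BlockPair i j
blockPair-2+ = mk⇔ (λ { (even-2+ e , refl) → e , refl }) (λ { (e , refl) → even-2+ e , refl })

⟨$⟩ʳ-injective : ∀ {n} (π : Perm n) {a b} → π ⟨$⟩ʳ a ≡ π ⟨$⟩ʳ b → a ≡ b
⟨$⟩ʳ-injective π {a} {b} eq = begin
  a                   ≡⟨ inverseˡ π ⟨
  π ⟨$⟩ˡ (π ⟨$⟩ʳ a)   ≡⟨ cong (π ⟨$⟩ˡ_) eq ⟩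
  π ⟨$⟩ˡ (π ⟨$⟩ʳ b)   ≡⟨ inverseˡ π ⟩
  b                   ∎
  where open ≡-Reasoning

fromℕ<-mono-< : ∀ {i j n} (p : i < n) (q : j < n) → i < j → fromℕ< p <ᶠ fromℕ< q
fromℕ<-mono-< p q = subst₂ _<_ (sym (toℕ-fromℕ< p)) (sym (toℕ-fromℕ< q))

StrictlyIncreasing : ∀ {k n} → (Fin k → Fin n) → Set
StrictlyIncreasing f = ∀ {a b} → a <ᶠ b → f a <ᶠ f b

increasing⇒injective : ∀ {k n} {f : Fin k → Fin n} → StrictlyIncreasing f → ∀ {a b} → f a ≡ f b → a ≡ b
increasing⇒injective mono {a} {b} eq with <ᶠ-cmp a b
... | tri< a<b _ _ = contradiction (cong toℕ eq) (<⇒≢ (mono a<b))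
... | tri≈ _ a≡b _ = a≡b
... | tri> _ _ b<a = contradiction (cong toℕ (sym eq)) (<⇒≢ (mono b<a))

increasing⇒≤ : ∀ {k n} {f : Fin k → Fin n} → StrictlyIncreasing f → ∀ a → toℕ a ≤ toℕ (f a)
increasing⇒≤ {k} {f = f} mono a =
  subst (λ x → toℕ a ≤ toℕ (f x)) (fromℕ<-toℕ a (toℕ<n a)) (bound (toℕ a) (toℕ<n a))
  where
  bound : ∀ i (p : i < k) → i ≤ toℕ (f (fromℕ< p))
  bound zero    _ = z≤n
  bound (suc i) p = ≤-<-trans (bound i i<k) (mono (fromℕ<-mono-< i<k p (n<1+n i)))
    where i<k = <-trans (n<1+n i) p

ascending-pairs-determine-order : ∀ {k m n} (f : Fin k → Fin m) (g : Fin k → Fin n) →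
  (∀ {a b} → f a ≡ f b → a ≡ b) → (∀ {a b} → a <ᶠ b → (f a <ᶠ f b ⇔ g a <ᶠ g b)) →
  ∀ a b → g a <ᶠ g b → f a <ᶠ f b
ascending-pairs-determine-order f g f-inj same a b ga<gb with <ᶠ-cmp a b
... | tri< a<b _ _ = from (same a<b) ga<gb
... | tri≈ _ refl _ = contradiction ga<gb (<-irrefl refl)
... | tri> _ a≢b b<a = ≤∧≢⇒< (≮⇒≥ (<-asym ga<gb ∘ to (same b<a))) (a≢b ∘ f-inj ∘ toℕ-injective)

SameInversions : ∀ {n} → Perm n → Perm n → Set
SameInversions π ρ = ∀ {a b} → a <ᶠ b → (π ⟨$⟩ʳ a <ᶠ π ⟨$⟩ʳ b ⇔ ρ ⟨$⟩ʳ a <ᶠ ρ ⟨$⟩ʳ b)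

-- Both π ∘ ρ⁻¹ and ρ ∘ π⁻¹ are strictly increasing, so each is pointwise ≥ the identity;
-- as they are mutually inverse, both are the identity.
same-inversions⇒≈ : ∀ {n} (π ρ : Perm n) → SameInversions π ρ → ∀ a → π ⟨$⟩ʳ a ≡ ρ ⟨$⟩ʳ a
same-inversions⇒≈ π ρ same a = begin
  π ⟨$⟩ʳ a                    ≡⟨ cong (π ⟨$⟩ʳ_) (inverseˡ ρ) ⟨
  π ⟨$⟩ʳ (ρ ⟨$⟩ˡ (ρ ⟨$⟩ʳ a))  ≡⟨ toℕ-injective (≤-antisym upper (increasing⇒≤ (∘⁻¹-increasing ρ π same) x)) ⟩
  ρ ⟨$⟩ʳ a                    ∎
  where
  open ≡-Reasoning
  ∘⁻¹-increasing : (σ τ : Perm _) → SameInversions τ σ → StrictlyIncreasing (λ x → τ ⟨$⟩ʳ (σ ⟨$⟩ˡ x))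
  ∘⁻¹-increasing σ τ same′ {x} {y} x<y =
    ascending-pairs-determine-order (τ ⟨$⟩ʳ_) (σ ⟨$⟩ʳ_) (⟨$⟩ʳ-injective τ) same′ _ _
      (subst₂ _<ᶠ_ (sym (inverseʳ σ)) (sym (inverseʳ σ)) x<y)
  x = ρ ⟨$⟩ʳ a
  upper : toℕ (π ⟨$⟩ʳ (ρ ⟨$⟩ˡ x)) ≤ toℕ x
  upper = ≤-trans (increasing⇒≤ (∘⁻¹-increasing π ρ (⇔-sym ∘ same)) (π ⟨$⟩ʳ (ρ ⟨$⟩ˡ x)))
                  (≤-reflexive (cong toℕ (trans (cong (ρ ⟨$⟩ʳ_) (inverseˡ π)) (inverseʳ ρ))))

contains-if-ascending-pairs : ∀ {k n} (σ : Perm n) (π : Perm k) (c : Fin k → Fin n) → StrictlyIncreasing c →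
  (∀ {a b} → a <ᶠ b → (σ ⟨$⟩ʳ c a <ᶠ σ ⟨$⟩ʳ c b ⇔ π ⟨$⟩ʳ a <ᶠ π ⟨$⟩ʳ b)) → Contains σ π
contains-if-ascending-pairs σ π c mono same = c , (λ _ _ → mono) , λ a b →
  mk⇔ (ascending-pairs-determine-order (π ⟨$⟩ʳ_) (λ x → σ ⟨$⟩ʳ c x) (⟨$⟩ʳ-injective π) (⇔-sym ∘ same) a b)
      (ascending-pairs-determine-order (λ x → σ ⟨$⟩ʳ c x) (π ⟨$⟩ʳ_)
        (increasing⇒injective mono ∘ ⟨$⟩ʳ-injective σ) same a b)

triple : ∀ {n} → Fin n → Fin n → Fin n → Fin 3 → Fin n
triple a b c 0F = a
triple a b c 1F = b
triple a b c 2F = c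

ascending-pairs-of-Fin3 : (P : Fin 3 → Fin 3 → Set) → P 0F 1F → P 0F 2F → P 1F 2F → ∀ {a b} → a <ᶠ b → P a b
ascending-pairs-of-Fin3 P p01 p02 p12 {0F} {1F} _ = p01
ascending-pairs-of-Fin3 P p01 p02 p12 {0F} {2F} _ = p02
ascending-pairs-of-Fin3 P p01 p02 p12 {1F} {2F} _ = p12
ascending-pairs-of-Fin3 P p01 p02 p12 {0F} {0F} ()
ascending-pairs-of-Fin3 P p01 p02 p12 {1F} {0F} ()
ascending-pairs-of-Fin3 P p01 p02 p12 {2F} {0F} ()
ascending-pairs-of-Fin3 P p01 p02 p12 {1F} {1F} (s<s ())
ascending-pairs-of-Fin3 P p01 p02 p12 {2F} {1F} (s<s ())
ascending-pairs-of-Fin3 P p01 p02 p12 {2F} {2F} (s<s (s<s ()))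

contains-triple : ∀ {n} (σ : Perm n) (π : Perm 3) {a b c : Fin n} → a <ᶠ b → b <ᶠ c →
  (σ ⟨$⟩ʳ a <ᶠ σ ⟨$⟩ʳ b ⇔ π ⟨$⟩ʳ 0F <ᶠ π ⟨$⟩ʳ 1F) →
  (σ ⟨$⟩ʳ a <ᶠ σ ⟨$⟩ʳ c ⇔ π ⟨$⟩ʳ 0F <ᶠ π ⟨$⟩ʳ 2F) →
  (σ ⟨$⟩ʳ b <ᶠ σ ⟨$⟩ʳ c ⇔ π ⟨$⟩ʳ 1F <ᶠ π ⟨$⟩ʳ 2F) → Contains σ π
contains-triple σ π {a} {b} {c} a<b b<c ab ac bc = contains-if-ascending-pairs σ π (triple a b c)
  (ascending-pairs-of-Fin3 (λ i j → triple a b c i <ᶠ triple a b c j) a<b (<-trans a<b b<c) b<c)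
  (ascending-pairs-of-Fin3 (λ i j → σ ⟨$⟩ʳ triple a b c i <ᶠ σ ⟨$⟩ʳ triple a b c j ⇔ π ⟨$⟩ʳ i <ᶠ π ⟨$⟩ʳ j)
    ab ac bc)

module _ {N : ℕ} (τ : Perm N) where

  value : ℕ → ℕ
  value i with i <? N
  ... | yes p = toℕ (τ ⟨$⟩ʳ fromℕ< p)
  ... | no _  = 0

  value-fromℕ< : ∀ {i} (p : i < N) → value i ≡ toℕ (τ ⟨$⟩ʳ fromℕ< p)
  value-fromℕ< {i} p with i <? N
  ... | yes _ = refl
  ... | no ¬p = contradiction p ¬p

  value-toℕ : (a : Fin N) → value (toℕ a) ≡ toℕ (τ ⟨$⟩ʳ a)
  value-toℕ a = trans (value-fromℕ< (toℕ<n a)) (cong (toℕ ∘ (τ ⟨$⟩ʳ_)) (fromℕ<-toℕ a (toℕ<n a)))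

  value-injective : ∀ {i j} → i < N → j < N → value i ≡ value j → i ≡ j
  value-injective {i} {j} p q eq = begin
    i                ≡⟨ toℕ-fromℕ< p ⟨
    toℕ (fromℕ< p)   ≡⟨ cong toℕ (⟨$⟩ʳ-injective τ (toℕ-injective values-eq)) ⟩
    toℕ (fromℕ< q)   ≡⟨ toℕ-fromℕ< q ⟩
    j                ∎
    where
    open ≡-Reasoning
    values-eq : toℕ (τ ⟨$⟩ʳ fromℕ< p) ≡ toℕ (τ ⟨$⟩ʳ fromℕ< q)
    values-eq = trans (sym (value-fromℕ< p)) (trans eq (value-fromℕ< q))

  rise-or-fall : ∀ {i} → suc i < N → value i < value (suc i) ⊎ value (suc i) < value i
  rise-or-fall {i} p with <-cmp (value i) (value (suc i))
  ... | tri< lt _ _ = inj₁ lt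
  ... | tri≈ _ eq _ = contradiction (sym (value-injective (<-trans (n<1+n i) p) p eq)) 1+n≢n
  ... | tri> _ _ gt = inj₂ gt

  val-< : ∀ {i} → i < N → val τ i ≡ just (value i)
  val-< {i} p with i <? N
  ... | yes _ = refl
  ... | no ¬p = contradiction p ¬p

  val-≮ : ∀ {i} → ¬ i < N → val τ i ≡ nothing
  val-≮ {i} ¬p with i <? N
  ... | yes p = contradiction p ¬p
  ... | no _  = refl

  asc-of-rise : ∀ {i} → suc i < N → value i < value (suc i) → isAsc τ i ≡ 1 × isDes τ i ≡ 0
  asc-of-rise {i} p lt rewrite val-< (<-trans (n<1+n i) p) | val-< p
    with suc (value i) ≤? value (suc i) | suc (value (suc i)) ≤? value i
  ... | yes _  | no _   = refl , refl
  ... | no ¬lt | _      = contradiction lt ¬lt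
  ... | _      | yes gt = contradiction gt (<-asym lt)

  des-of-fall : ∀ {i} → suc i < N → value (suc i) < value i → isAsc τ i ≡ 0 × isDes τ i ≡ 1
  des-of-fall {i} p gt rewrite val-< (<-trans (n<1+n i) p) | val-< p
    with suc (value i) ≤? value (suc i) | suc (value (suc i)) ≤? value i
  ... | no _  | yes _   = refl , refl
  ... | _     | no ¬gt  = contradiction gt ¬gt
  ... | yes lt | _      = contradiction lt (<-asym gt)

  des-at-end : ∀ {i} → ¬ suc i < N → isDes τ i ≡ 0
  des-at-end {i} ¬p rewrite val-≮ ¬p with val τ i
  ... | just _  = refl
  ... | nothing = refl

  des≤1 : ∀ i → isDes τ i ≤ 1
  des≤1 i = by-position (suc i <? N)
    where
    by-position : Dec (suc i < N) → isDes τ i ≤ 1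
    by-position (no ¬p) rewrite des-at-end ¬p = z≤n
    by-position (yes p) with rise-or-fall p
    ... | inj₁ lt rewrite proj₂ (asc-of-rise p lt) = z≤n
    ... | inj₂ gt rewrite proj₂ (des-of-fall p gt) = ≤-refl

  value-<⇔ : ∀ {i j} (p : i < N) (q : j < N) → (value i < value j ⇔ τ ⟨$⟩ʳ fromℕ< p <ᶠ τ ⟨$⟩ʳ fromℕ< q)
  value-<⇔ p q = mk⇔ (subst₂ _<_ (value-fromℕ< p) (value-fromℕ< q))
                     (subst₂ _<_ (sym (value-fromℕ< p)) (sym (value-fromℕ< q)))

  AtMostOneLargerLater : Set
  AtMostOneLargerLater = ∀ {i j k} → i < j → j < k → k < N → value i < value j → value i < value k → ⊥

  contains-at-positions : (π : Perm 3) → ∀ {i j k} → i < j → j < k → k < N →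
    (value i < value j ⇔ π ⟨$⟩ʳ 0F <ᶠ π ⟨$⟩ʳ 1F) →
    (value i < value k ⇔ π ⟨$⟩ʳ 0F <ᶠ π ⟨$⟩ʳ 2F) →
    (value j < value k ⇔ π ⟨$⟩ʳ 1F <ᶠ π ⟨$⟩ʳ 2F) → Contains τ π
  contains-at-positions π i<j j<k k<N ij ik jk =
    contains-triple τ π (fromℕ<-mono-< i<N j<N i<j) (fromℕ<-mono-< j<N k<N j<k)
      (ij ⇔-∘ ⇔-sym (value-<⇔ i<N j<N)) (ik ⇔-∘ ⇔-sym (value-<⇔ i<N k<N)) (jk ⇔-∘ ⇔-sym (value-<⇔ j<N k<N))
    where
    j<N = <-trans j<k k<N
    i<N = <-trans i<j j<N

  avoids⇒atMostOneLargerLater : Avoids τ p123 → Avoids τ p132 → AtMostOneLargerLater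
  avoids⇒atMostOneLargerLater avoid123 avoid132 {i} {j} {k} i<j j<k k<N vi<vj vi<vk
    with <-cmp (value j) (value k)
  ... | tri< vj<vk _ _ = avoid123 (contains-at-positions p123 i<j j<k k<N
          (⇔-both vi<vj z<s) (⇔-both vi<vk z<s) (⇔-both vj<vk (s<s z<s)))
  ... | tri≈ _ vj≡vk _ = <⇒≢ j<k (value-injective (<-trans j<k k<N) k<N vj≡vk)
  ... | tri> _ _ vk<vj = avoid132 (contains-at-positions p132 i<j j<k k<N
          (⇔-both vi<vj z<s) (⇔-both vi<vk z<s) (⇔-neither (<-asym vk<vj) λ { (s<s ()) }))

  atMostOneLargerLater⇒avoids : (π : Perm 3) → π ⟨$⟩ʳ 0F <ᶠ π ⟨$⟩ʳ 1F → π ⟨$⟩ʳ 0F <ᶠ π ⟨$⟩ʳ 2F →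
    AtMostOneLargerLater → Avoids τ π
  atMostOneLargerLater⇒avoids π π01 π02 atMostOne (c , mono , iso) =
    atMostOne (mono 0F 1F z<s) (mono 1F 2F (s<s z<s)) (toℕ<n (c 2F)) (rise 0F 1F π01) (rise 0F 2F π02)
    where
    rise : ∀ a b → π ⟨$⟩ʳ a <ᶠ π ⟨$⟩ʳ b → value (toℕ (c a)) < value (toℕ (c b))
    rise a b π-rise = subst₂ _<_ (sym (value-toℕ (c a))) (sym (value-toℕ (c b))) (from (iso a b) π-rise)

  descents-after-ascents⇒ballot : isDes τ 0 ≡ 0 → (∀ i → isDes τ (suc i) ≤ isAsc τ i) → IsBallot τ
  descents-after-ascents⇒ballot des₀ des≤asc m _ = ≤-trans (m≤m+n _ _) (lead m)
    where
    lead : ∀ m → desBelow τ m + isDes τ m ≤ ascBelow τ m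
    lead zero    = ≤-reflexive des₀
    lead (suc m) = +-mono-≤ (lead m) (des≤asc m)

  AscendsAtEven : Set
  AscendsAtEven = ∀ {i} → Even i → suc i < N → value i < value (suc i)

  ascendsAtEven⇒ballot : AscendsAtEven → IsBallot τ
  ascendsAtEven⇒ballot ascends = descents-after-ascents⇒ballot (no-des-at-even even-zero) des≤asc
    where
    no-des-at-even : ∀ {i} → Even i → isDes τ i ≡ 0
    no-des-at-even {i} e = by-position (suc i <? N)
      where
      by-position : Dec (suc i < N) → isDes τ i ≡ 0
      by-position (yes p) = proj₂ (asc-of-rise p (ascends e p))
      by-position (no ¬p) = des-at-end ¬p
    des≤asc : ∀ i → isDes τ (suc i) ≤ isAsc τ i
    des≤asc i with even-or-odd i
    ... | inj₂ e rewrite no-des-at-even e = z≤n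
    ... | inj₁ e = by-position (suc i <? N)
      where
      by-position : Dec (suc i < N) → isDes τ (suc i) ≤ isAsc τ i
      by-position (yes p) rewrite proj₁ (asc-of-rise p (ascends e p)) = des≤1 (suc i)
      by-position (no ¬p) rewrite des-at-end (¬p ∘ <-trans (n<1+n (suc i))) = z≤n

  BlockShaped : Set
  BlockShaped = ∀ {i j} → i < j → j < N → (value i < value j ⇔ BlockPair i j)

  module _ (ballot : IsBallot τ) (atMostOne : AtMostOneLargerLater) where

    mutual
      ascends-at-even : AscendsAtEven
      ascends-at-even {i} e p with rise-or-fall p
      ... | inj₁ rise = rise
      ... | inj₂ fall = contradiction (ballot (suc i) p) (<⇒≱ excess)
        where
        open ≤-Reasoning
        falls : isAsc τ i ≡ 0 × isDes τ i ≡ 1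
        falls = des-of-fall p fall
        excess : ascBelow τ (suc i) < desBelow τ (suc i)
        excess = begin-strict
          ascBelow τ i + isAsc τ i ≡⟨ cong₂ _+_ (balanced e (<-trans (n<1+n i) p)) (proj₁ falls) ⟩
          desBelow τ i + 0         <⟨ +-monoʳ-< (desBelow τ i) z<s ⟩
          desBelow τ i + 1         ≡⟨ cong (desBelow τ i +_) (proj₂ falls) ⟨
          desBelow τ i + isDes τ i ∎

      balanced : ∀ {i} → Even i → i < N → ascBelow τ i ≡ desBelow τ i
      balanced even-zero _ = refl
      balanced {suc (suc i)} (even-2+ e) p = begin
        ascBelow τ i + isAsc τ i + isAsc τ (suc i)
          ≡⟨ cong₂ _+_ (cong₂ _+_ (balanced e i<N) (proj₁ rise-at-i)) (proj₁ fall-at-1+i) ⟩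
        desBelow τ i + 1 + 0                       ≡⟨ +-identityʳ _ ⟩
        desBelow τ i + 1                           ≡⟨ cong (_+ 1) (+-identityʳ _) ⟨
        desBelow τ i + 0 + 1
          ≡⟨ cong₂ _+_ (cong (desBelow τ i +_) (proj₂ rise-at-i)) (proj₂ fall-at-1+i) ⟨
        desBelow τ i + isDes τ i + isDes τ (suc i) ∎
        where
        open ≡-Reasoning
        1+i<N = <-trans (n<1+n _) p
        i<N = <-trans (n<1+n _) 1+i<N
        rise = ascends-at-even e 1+i<N
        rise-at-i = asc-of-rise 1+i<N rise
        fall-at-1+i : isAsc τ (suc i) ≡ 0 × isDes τ (suc i) ≡ 1
        fall-at-1+i with rise-or-fall p
        ... | inj₂ fall  = des-of-fall p fall
        ... | inj₁ rise′ = ⊥-elim (atMostOne (n<1+n i) (n<1+n (suc i)) p rise (<-trans rise rise′))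

    rises-only-in-blocks : ∀ {i j} → i < j → j < N → value i < value j → BlockPair i j
    rises-only-in-blocks {i} i<j j<N rise with even-or-odd i
    ... | inj₁ e with m≤n⇒m<n∨m≡n i<j
    ...   | inj₂ refl = e , refl
    ...   | inj₁ 1+i<j = ⊥-elim (atMostOne (n<1+n i) 1+i<j j<N (ascends-at-even e (<-trans 1+i<j j<N)) rise)
    rises-only-in-blocks {suc h} i<j j<N rise | inj₂ (even-2+ e) =
      ⊥-elim (atMostOne (n<1+n h) i<j j<N rise-at-h (<-trans rise-at-h rise))
      where rise-at-h = ascends-at-even e (<-trans i<j j<N)

    ballot⇒blockShaped : BlockShaped
    ballot⇒blockShaped i<j j<N = mk⇔ (rises-only-in-blocks i<j j<N) λ { (e , refl) → ascends-at-even e j<N }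

  InB⇒blockShaped : InB τ → BlockShaped
  InB⇒blockShaped (ballot , avoid123 , avoid132) =
    ballot⇒blockShaped ballot (avoids⇒atMostOneLargerLater avoid123 avoid132)

  blockShaped⇒InB : BlockShaped → InB τ
  blockShaped⇒InB shaped =
    ascendsAtEven⇒ballot (λ e p → from (shaped (n<1+n _) p) (e , refl)) ,
    atMostOneLargerLater⇒avoids p123 z<s z<s atMostOne ,
    atMostOneLargerLater⇒avoids p132 z<s z<s atMostOne
    where
    atMostOne : AtMostOneLargerLater
    atMostOne i<j j<k k<N vi<vj vi<vk =
      <⇒≢ j<k (blockPair-unique (to (shaped i<j (<-trans j<k k<N)) vi<vj)
                                (to (shaped (<-trans i<j j<k) k<N) vi<vk))

  blockShaped-Fin : BlockShaped → ∀ {a b} → a <ᶠ b → (τ ⟨$⟩ʳ a <ᶠ τ ⟨$⟩ʳ b ⇔ BlockPair (toℕ a) (toℕ b))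
  blockShaped-Fin shaped {a} {b} a<b =
    shaped a<b (toℕ<n b) ⇔-∘ mk⇔ (subst₂ _<_ (sym (value-toℕ a)) (sym (value-toℕ b)))
                                 (subst₂ _<_ (value-toℕ a) (value-toℕ b))

  blockShaped-from-Fin : (∀ {a b} → a <ᶠ b → (τ ⟨$⟩ʳ a <ᶠ τ ⟨$⟩ʳ b ⇔ BlockPair (toℕ a) (toℕ b))) → BlockShaped
  blockShaped-from-Fin shaped {i} {j} i<j j<N =
    subst₂ (λ x y → τ ⟨$⟩ʳ fromℕ< i<N <ᶠ τ ⟨$⟩ʳ fromℕ< j<N ⇔ BlockPair x y)
           (toℕ-fromℕ< i<N) (toℕ-fromℕ< j<N) (shaped (fromℕ<-mono-< i<N j<N i<j))
      ⇔-∘ value-<⇔ i<N j<N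
    where i<N = <-trans i<j j<N

blockShaped-unique : ∀ {N} (τ σ : Perm N) → BlockShaped τ → BlockShaped σ → ∀ a → τ ⟨$⟩ʳ a ≡ σ ⟨$⟩ʳ a
blockShaped-unique τ σ τ-shaped σ-shaped =
  same-inversions⇒≈ τ σ λ a<b → ⇔-sym (blockShaped-Fin σ σ-shaped a<b) ⇔-∘ blockShaped-Fin τ τ-shaped a<b

pairSwap : ∀ n → Perm n
pairSwap zero          = id
pairSwap (suc zero)    = id
pairSwap (suc (suc n)) = swap (pairSwap n)

pairSwap-descents : ∀ {n} {a b : Fin n} → a <ᶠ b →
  (pairSwap n ⟨$⟩ʳ b <ᶠ pairSwap n ⟨$⟩ʳ a ⇔ BlockPair (toℕ a) (toℕ b))
pairSwap-descents {suc (suc n)} {0F} {1F} _ = ⇔-both z<s (even-zero , refl)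
pairSwap-descents {suc (suc n)} {0F} {fsuc (fsuc b)} _ = ⇔-neither (λ { (s<s ()) }) (λ { (_ , ()) })
pairSwap-descents {suc (suc n)} {1F} {fsuc (fsuc b)} _ = ⇔-neither (λ ()) (λ { (() , _) })
pairSwap-descents {suc (suc n)} {fsuc (fsuc a)} {fsuc (fsuc b)} (s<s (s<s a<b)) =
  ⇔-sym blockPair-2+ ⇔-∘ (pairSwap-descents a<b ⇔-∘ mk⇔ (λ { (s<s (s<s lt)) → lt }) (λ lt → s<s (s<s lt)))
pairSwap-descents {_} {0F} {0F} ()
pairSwap-descents {_} {fsuc _} {0F} ()
pairSwap-descents {suc (suc n)} {1F} {1F} (s<s ())
pairSwap-descents {suc (suc n)} {fsuc (fsuc _)} {1F} (s<s ())

opposite-<⇔ : ∀ {n} (x y : Fin n) → (opposite x <ᶠ opposite y ⇔ y <ᶠ x)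
opposite-<⇔ {n} x y rewrite opposite-prop x | opposite-prop y =
  mk⇔ (s<s⁻¹ ∘ ∸-cancelʳ-< {o = n}) (λ y<x → ∸-monoʳ-< (s<s y<x) (toℕ<n x))

-- (n-1) n (n-3) (n-2) … in the paper's one-based notation, ending in … 1 2 or … 2 3 1.
reversePairSwap : ∀ n → Perm n
reversePairSwap n = pairSwap n ∘ₚ reverse

reversePairSwap-blockShaped : ∀ n → BlockShaped (reversePairSwap n)
reversePairSwap-blockShaped n =
  blockShaped-from-Fin (reversePairSwap n) λ a<b → pairSwap-descents a<b ⇔-∘ opposite-<⇔ _ _

theorem3p2 : (n : ℕ) → Σ (Perm (suc n)) λ σ → InB σ × ((τ : Perm (suc n)) → InB τ → (i : Fin (suc n)) → τ ⟨$⟩ʳ i ≡ σ ⟨$⟩ʳ i)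
theorem3p2 n = σ , blockShaped⇒InB σ σ-shaped ,
  λ τ τ∈B → blockShaped-unique τ σ (InB⇒blockShaped τ τ∈B) σ-shaped
  where
  σ = reversePairSwap (suc n)
  σ-shaped = reversePairSwap-blockShaped (suc n)
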